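{- Suppose $\bar v=E\bar c\in\mathbb{N}^s$ where $\bar c=[c_0,\dots,c_{s-1}]^t\in\mathbb{R}^s$ satisfies $1<c_0=\min\{c_0,\dots,c_{s-1}\}$. Then there exists a vector $\bar w=E\bar d\in\mathfrak{J}$, $\bar d=[d_0,\dots,d_{s-1}]^t$, with $\bar w<\bar v$ and $c_0-1\le d_0=\min\{d_0,\dots,d_{s-1}\}$.
   Context: Let $p$ be a prime, $s\ge1$. With $\bar e_i$ the standard basis of $\mathbb{R}^s$ and indices mod $s$, $\bar\varepsilon_i:=p\bar e_{i-1}-\bar e_i$ and $E:=[\bar\varepsilon_0,\dots,\bar\varepsilon_{s-1}]$. For $N=\sum_jn_jp^j$ (base $p$), $\Gamma(N)=[u_0,\dots,u_{s-1}]^t$ with $u_i=\sum_{j\equiv i\pmod s}n_j$, and $\mathfrak{J}:=\{\Gamma(k):k\text{ a positive multiple of }p^s-1\}$. $\bar x<\bar y$ means $x_i\le y_i$ for all $i$ and $\bar x\neq\bar y$.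
   Formalization: The vectors $\bar c$ and $\bar d$ are taken in ℚ^s instead of $\mathbb{R}^s$. -}

module Defs where

open import Data.Nat as ℕ using (ℕ; zero; suc; NonZero; _%_; _≡ᵇ_)
open import Data.Nat.Primality using (Prime; prime⇒nonZero)
open import Data.Fin as F using (Fin; toℕ)
open import Data.Product using (∃; _×_)
open import Data.Nat.Divisibility using (_∣_)
open import Relation.Nullary using (¬_)
open import Relation.Binary.PropositionalEquality using (_≡_)
open import Data.Bool using (if_then_else_)
open import Data.List using (List; map; upTo)
open import Data.Nat.ListAction using (sum)
open import Data.Integer using (+_)
open import Data.Rational using (ℚ; 0ℚ; 1ℚ; _+_; _*_; _-_; _/_)

ι : ℕ → ℚ
ι n = + n / 1

Σ : ∀ {n} → (Fin n → ℚ) → ℚ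
Σ {zero}  f = 0ℚ
Σ {suc n} f = f F.zero + Σ (λ i → f (F.suc i))

predMod : (s : ℕ) .{{_ : NonZero s}} → Fin s → ℕ
predMod s i = (toℕ i ℕ.+ (s ℕ.∸ 1)) % s

e : (s : ℕ) → Fin s → Fin s → ℚ
e s i j = if toℕ j ≡ᵇ toℕ i then 1ℚ else 0ℚ

ePred : (s : ℕ) .{{_ : NonZero s}} → Fin s → Fin s → ℚ
ePred s i j = if toℕ j ≡ᵇ predMod s i then 1ℚ else 0ℚ

ε : (p s : ℕ) .{{_ : NonZero s}} → Fin s → Fin s → ℚ
ε p s i j = ι p * ePred s i j - e s i j

-- E c̄ = Σ_i c_i ε̄_i  (E = [ε̄_0, …, ε̄_{s-1}] applied to c̄)
Emul : (p s : ℕ) .{{_ : NonZero s}} → (Fin s → ℚ) → Fin s → ℚ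
Emul p s c j = Σ (λ i → c i * ε p s i j)

digit : (p : ℕ) .{{_ : NonZero p}} → ℕ → ℕ → ℕ
digit p zero    N = N % p
digit p (suc j) N = digit p j (N ℕ./ p)

-- Γ(N)_i = Σ_{j ≡ i mod s} n_j ; digits at positions j > N vanish (p ≥ 2),
-- so summing over j ∈ {0,…,N} covers all digits.
Γ : (p : ℕ) → Prime p → (s : ℕ) .{{_ : NonZero s}} → ℕ → Fin s → ℕ
Γ p pp s N i = sum (map (λ j → if (j % s) ≡ᵇ toℕ i then digit p j N else 0) (upTo (suc N)))
  where instance _ = prime⇒nonZero pp

In𝔍 : (p : ℕ) → Prime p → (s : ℕ) .{{_ : NonZero s}} → (Fin s → ℕ) → Set
In𝔍 p pp s w = ∃ λ k → (0 ℕ.< k) × ((p ℕ.^ s ℕ.∸ 1) ∣ k) × (∀ i → Γ p pp s k i ≡ w i)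

_<ᵥ_ : ∀ {s} → (Fin s → ℕ) → (Fin s → ℕ) → Set
_<ᵥ_ {s} x y = (∀ i → x i ℕ.≤ y i) × ¬ (∀ i → x i ≡ y i)

{-# OPTIONS --safe #-}
module Submission where

-- Let a be the natural number with a < c₀ ≤ a + 1 and read indices modulo s, so that
-- (E x)ₙ = p xₙ₊₁ − xₙ. The integers anchored m n, equal to a for m = 0 and to
-- p · anchored m (n+1) − vₙ for m + 1, are cₙ − pᵐ (cₙ₊ₘ − a); minimality of c₀ gives
-- anchored m 0 ≤ a and anchored s n ≤ a. Hence dₙ = max_{m<s} anchored m n is an integer with
-- d₀ = a ≤ dₙ and dₙ ≤ p dₙ₊₁ ≤ dₙ + vₙ, i.e. 0 ≤ w := E d ≤ v. Telescoping gives
-- Σᵢ pⁱ wᵢ = (pˢ − 1) a, and then w = Γ(k) for the multiple k of pˢ − 1 whose base-p digit at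
-- position b s + i is 1 exactly when b < wᵢ. Finally w ≠ v: otherwise c and d both solve
-- E x = v, and the formula for anchored s 0 gives c₀ − pˢ (c₀ − a) = a, impossible since
-- c₀ > a and pˢ > 1.

open import Data.Nat.Base using (ℕ; NonZero; NonTrivial)
open import Data.Nat.Primality using (Prime)

module FiniteSums where

  open import Data.Bool using (true; false; if_then_else_)
  open import Data.List using (map; upTo; applyUpTo)
  open import Data.List.Properties using (map-upTo)
  open import Data.Nat
  open import Data.Nat.ListAction using (sum)
  open import Data.Nat.Properties using (+-assoc; +-identityʳ; m≤m+n)
  open import Function using (_∘_)
  open import Relation.Binary.PropositionalEquality

  sumBelow : ℕ → (ℕ → ℕ) → ℕ
  sumBelow zero    f = 0
  sumBelow (suc n) f = f 0 + sumBelow n (f ∘ suc)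

  sum-applyUpTo : ∀ f n → sum (applyUpTo f n) ≡ sumBelow n f
  sum-applyUpTo f zero    = refl
  sum-applyUpTo f (suc n) = cong (f 0 +_) (sum-applyUpTo (f ∘ suc) n)

  sum-map-upTo : ∀ f n → sum (map f (upTo n)) ≡ sumBelow n f
  sum-map-upTo f n = trans (cong sum (map-upTo f n)) (sum-applyUpTo f n)

  sumBelow-cong : ∀ {f g} n → (∀ {j} → j < n → f j ≡ g j) → sumBelow n f ≡ sumBelow n g
  sumBelow-cong zero    f≗g = refl
  sumBelow-cong (suc n) f≗g = cong₂ _+_ (f≗g z<s) (sumBelow-cong n (f≗g ∘ s<s))

  sumBelow-zero : ∀ n → sumBelow n (λ _ → 0) ≡ 0
  sumBelow-zero zero    = refl
  sumBelow-zero (suc n) = sumBelow-zero n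

  sumBelow-+ : ∀ f m n → sumBelow (m + n) f ≡ sumBelow m f + sumBelow n (λ j → f (m + j))
  sumBelow-+ f zero    n = refl
  sumBelow-+ f (suc m) n = trans (cong (f 0 +_) (sumBelow-+ (f ∘ suc) m n)) (sym (+-assoc (f 0) _ _))

  sumBelow-vanish : ∀ f m n → (∀ {j} → m ≤ j → f j ≡ 0) → sumBelow (m + n) f ≡ sumBelow m f
  sumBelow-vanish f m n f≡0 = begin
    sumBelow (m + n) f                           ≡⟨ sumBelow-+ f m n ⟩
    sumBelow m f + sumBelow n (λ j → f (m + j))  ≡⟨ cong (sumBelow m f +_) (sumBelow-cong n λ _ → f≡0 (m≤m+n m _)) ⟩
    sumBelow m f + sumBelow n (λ _ → 0)          ≡⟨ cong (sumBelow m f +_) (sumBelow-zero n) ⟩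
    sumBelow m f + 0                             ≡⟨ +-identityʳ _ ⟩
    sumBelow m f                                 ∎
    where open ≡-Reasoning

  sumBelow-select : ∀ f {i n} → i < n → sumBelow n (λ j → if j ≡ᵇ i then f j else 0) ≡ f i
  sumBelow-select f {zero}  {suc n} _         = trans (cong (f 0 +_) (sumBelow-zero n)) (+-identityʳ (f 0))
  sumBelow-select f {suc i} {suc n} (s<s i<n) = sumBelow-select (f ∘ suc) i<n

  if-vanish : ∀ b {x} → x ≡ 0 → (if b then x else 0) ≡ 0
  if-vanish true  x≡0 = x≡0
  if-vanish false _   = refl

module Digits (p : ℕ) .{{p-nonTrivial : NonTrivial p}} where

  open import Data.Nat
  open import Data.Nat.DivMod
  open import Data.Nat.Divisibility using (divides)
  open import Data.Nat.Properties
  open import Data.Nat.Solver using (module +-*-Solver)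
  open import Function using (_∘_)
  open import Relation.Binary.PropositionalEquality
  open import Defs using (digit)
  open +-*-Solver using (solve; _:+_; _:*_; _:=_)

  instance
    p≢0 : NonZero p
    p≢0 = nonTrivial⇒nonZero p

  1<p : 1 < p
  1<p = nonTrivial⇒n>1 p

  fromDigits : (ℕ → ℕ) → ℕ → ℕ
  fromDigits D zero    = 0
  fromDigits D (suc n) = D 0 + p * fromDigits (D ∘ suc) n

  [x+p*y]%p≡x : ∀ {x} y → x < p → (x + p * y) % p ≡ x
  [x+p*y]%p≡x {x} y x<p = begin
    (x + p * y) % p  ≡⟨ cong (λ z → (x + z) % p) (*-comm p y) ⟩
    (x + y * p) % p  ≡⟨ [m+kn]%n≡m%n x y p ⟩
    x % p            ≡⟨ m<n⇒m%n≡m x<p ⟩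
    x                ∎
    where open ≡-Reasoning

  [x+p*y]/p≡y : ∀ {x} y → x < p → (x + p * y) / p ≡ y
  [x+p*y]/p≡y {x} y x<p = begin
    (x + p * y) / p    ≡⟨ +-distrib-/-∣ʳ x (divides y (*-comm p y)) ⟩
    x / p + p * y / p  ≡⟨ cong₂ _+_ (m<n⇒m/n≡0 x<p) (trans (cong (_/ p) (*-comm p y)) (m*n/n≡m y p)) ⟩
    y                  ∎
    where open ≡-Reasoning

  n<p^n : ∀ n → n < p ^ n
  n<p^n zero    = z<s
  n<p^n (suc n) = begin-strict
    suc n          ≤⟨ n<p^n n ⟩
    p ^ n          <⟨ m<m+n (p ^ n) (m^n>0 p n) ⟩
    p ^ n + p ^ n  ≡⟨ cong (p ^ n +_) (sym (+-identityʳ (p ^ n))) ⟩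
    2 * p ^ n      ≤⟨ *-monoˡ-≤ (p ^ n) 1<p ⟩
    p ^ suc n      ∎
    where open ≤-Reasoning

  digit-< : ∀ j {N} → N < p ^ j → digit p j N ≡ 0
  digit-< zero    {zero}  _       = m<n⇒m%n≡m (<-trans z<s 1<p)
  digit-< zero    {suc N} (s≤s ())
  digit-< (suc j) {N}     N<p^1+j = digit-< j (m<n*o⇒m/o<n (subst (N <_) (*-comm p (p ^ j)) N<p^1+j))

  digit-fromDigits : ∀ {D} → (∀ j → D j < p) → ∀ {j n} → j < n → digit p j (fromDigits D n) ≡ D j
  digit-fromDigits D<p {zero}  {suc n} _         = [x+p*y]%p≡x _ (D<p 0)
  digit-fromDigits D<p {suc j} {suc n} (s<s j<n) =
    trans (cong (digit p j) ([x+p*y]/p≡y _ (D<p 0))) (digit-fromDigits (D<p ∘ suc) j<n)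

  digit-fromDigits-≥ : ∀ {D} → (∀ j → D j < p) → ∀ {j n} → n ≤ j → digit p j (fromDigits D n) ≡ 0
  digit-fromDigits-≥ D<p {j}     {zero}  _         = digit-< j (m^n>0 p j)
  digit-fromDigits-≥ D<p {suc j} {suc n} (s≤s n≤j) =
    trans (cong (digit p j) ([x+p*y]/p≡y _ (D<p 0))) (digit-fromDigits-≥ (D<p ∘ suc) n≤j)

  fromDigits-cong : ∀ {D D′} n → (∀ {j} → j < n → D j ≡ D′ j) → fromDigits D n ≡ fromDigits D′ n
  fromDigits-cong zero    D≗D′ = refl
  fromDigits-cong (suc n) D≗D′ =
    cong₂ (λ x y → x + p * y) (D≗D′ z<s) (fromDigits-cong n (D≗D′ ∘ s<s))

  fromDigits-zero : ∀ n → fromDigits (λ _ → 0) n ≡ 0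
  fromDigits-zero zero    = refl
  fromDigits-zero (suc n) = trans (cong (p *_) (fromDigits-zero n)) (*-zeroʳ p)

  fromDigits-+ : ∀ D m n → fromDigits D (m + n) ≡ fromDigits D m + p ^ m * fromDigits (λ j → D (m + j)) n
  fromDigits-+ D zero    n = sym (+-identityʳ _)
  fromDigits-+ D (suc m) n = begin
    D 0 + p * fromDigits (D ∘ suc) (m + n)
      ≡⟨ cong (λ x → D 0 + p * x) (fromDigits-+ (D ∘ suc) m n) ⟩
    D 0 + p * (L + p ^ m * F)
      ≡⟨ solve 5 (λ d P L Q F → d :+ P :* (L :+ Q :* F) := (d :+ P :* L) :+ (P :* Q) :* F) refl (D 0) p L (p ^ m) F ⟩
    (D 0 + p * L) + p ^ suc m * F
      ∎
    where
      open ≡-Reasoning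
      L = fromDigits (D ∘ suc) m
      F = fromDigits (λ j → D (suc m + j)) n

  fromDigits-distrib-+ : ∀ D D′ n → fromDigits (λ j → D j + D′ j) n ≡ fromDigits D n + fromDigits D′ n
  fromDigits-distrib-+ D D′ zero    = refl
  fromDigits-distrib-+ D D′ (suc n) = begin
    (D 0 + D′ 0) + p * fromDigits (λ j → D (suc j) + D′ (suc j)) n
      ≡⟨ cong (λ x → (D 0 + D′ 0) + p * x) (fromDigits-distrib-+ (D ∘ suc) (D′ ∘ suc) n) ⟩
    (D 0 + D′ 0) + p * (F + F′)
      ≡⟨ solve 5 (λ d d′ P F F′ → (d :+ d′) :+ P :* (F :+ F′) := (d :+ P :* F) :+ (d′ :+ P :* F′))
                 refl (D 0) (D′ 0) p F F′ ⟩
    (D 0 + p * F) + (D′ 0 + p * F′)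
      ∎
    where
      open ≡-Reasoning
      F  = fromDigits (D ∘ suc) n
      F′ = fromDigits (D′ ∘ suc) n

  ≤-fromDigits : ∀ D {j n} → j < n → D j ≤ fromDigits D n
  ≤-fromDigits D {zero}  {suc n} _         = m≤m+n (D 0) _
  ≤-fromDigits D {suc j} {suc n} (s<s j<n) = begin
    D (suc j)                         ≤⟨ ≤-fromDigits (D ∘ suc) j<n ⟩
    fromDigits (D ∘ suc) n            ≤⟨ m≤n*m _ p ⟩
    p * fromDigits (D ∘ suc) n        ≤⟨ m≤n+m _ (D 0) ⟩
    D 0 + p * fromDigits (D ∘ suc) n  ∎
    where open ≤-Reasoning

  fromDigits-telescope : ∀ w x → (∀ i → w i + x i ≡ p * x (suc i)) →
                         ∀ m → fromDigits w m + x 0 ≡ p ^ m * x m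
  fromDigits-telescope w x w+x≡px zero    = sym (+-identityʳ (x 0))
  fromDigits-telescope w x w+x≡px (suc m) = begin
    (w 0 + p * F) + x 0
      ≡⟨ solve 4 (λ w₀ P F x₀ → (w₀ :+ P :* F) :+ x₀ := (w₀ :+ x₀) :+ P :* F) refl (w 0) p F (x 0) ⟩
    (w 0 + x 0) + p * F      ≡⟨ cong (_+ p * F) (w+x≡px 0) ⟩
    p * x 1 + p * F          ≡⟨ *-distribˡ-+ p (x 1) F ⟨
    p * (x 1 + F)            ≡⟨ cong (p *_) (trans (+-comm (x 1) F) IH) ⟩
    p * (p ^ m * x (suc m))  ≡⟨ *-assoc p (p ^ m) (x (suc m)) ⟨
    p ^ suc m * x (suc m)    ∎
    where
      open ≡-Reasoning
      F = fromDigits (w ∘ suc) m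
      IH = fromDigits-telescope (w ∘ suc) (x ∘ suc) (w+x≡px ∘ suc) m

module Realisation (p : ℕ) (pp : Prime p) (s : ℕ) .{{s≢0 : NonZero s}} where

  open import Data.Bool using (true; false; if_then_else_)
  open import Data.Fin using (Fin; toℕ)
  open import Data.Fin.Properties using (toℕ<n)
  open import Data.Nat
  open import Data.Nat.DivMod
  open import Data.Nat.Divisibility using (divides)
  open import Data.Nat.Primality using (prime⇒nonTrivial)
  open import Data.Nat.Properties
  open import Data.Nat.Solver using (module +-*-Solver)
  open import Data.Product using (∃; _,_; proj₁; proj₂)
  open import Function using (_∘_)
  open import Relation.Binary.PropositionalEquality
  open import Defs using (digit; Γ; In𝔍)
  open +-*-Solver using (solve; _:+_; _:*_; _:=_; con)
  open FiniteSums

  instance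
    p-nonTrivial : NonTrivial p
    p-nonTrivial = prime⇒nonTrivial pp

  open Digits p

  p^s∸1 : ℕ
  p^s∸1 = p ^ s ∸ 1

  p^s≡1+p^s∸1 : p ^ s ≡ 1 + p^s∸1
  p^s≡1+p^s∸1 = sym (m+[n∸m]≡n (m^n>0 p s))

  positive? : ℕ → ℕ
  positive? x = if 0 <ᵇ x then 1 else 0

  positive?+pred : ∀ x → positive? x + (x ∸ 1) ≡ x
  positive?+pred zero    = refl
  positive?+pred (suc x) = refl

  blockDigits : (ℕ → ℕ) → ℕ → ℕ
  blockDigits w j = if j / s <ᵇ w (j % s) then 1 else 0

  blockDigits<p : ∀ w j → blockDigits w j < p
  blockDigits<p w j with j / s <ᵇ w (j % s)
  ... | true  = 1<p
  ... | false = <-trans z<s 1<p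

  blockDigits-first : ∀ w {j} → j < s → blockDigits w j ≡ positive? (w j)
  blockDigits-first w j<s = cong₂ (λ b i → if b <ᵇ w i then 1 else 0) (m<n⇒m/n≡0 j<s) (m<n⇒m%n≡m j<s)

  [s+j]%s≡j%s : ∀ j → (s + j) % s ≡ j % s
  [s+j]%s≡j%s j = trans (cong (_% s) (+-comm s j)) ([m+n]%n≡m%n j s)

  blockDigits-shift : ∀ w j → blockDigits w (s + j) ≡ blockDigits ((_∸ 1) ∘ w) j
  blockDigits-shift w j rewrite [s+j]%s≡j%s j | m/n≡1+[m∸n]/n {s + j} {s} (m≤m+n s j) | m+n∸m≡n s j
    with w (j % s)
  ... | zero  = refl
  ... | suc _ = refl

  Γ-fromDigits : ∀ {D} → (∀ j → D j < p) → ∀ n (i : Fin s) →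
                 Γ p pp s (fromDigits D n) i ≡ sumBelow n (λ j → if j % s ≡ᵇ toℕ i then D j else 0)
  Γ-fromDigits {D} D<p n i = begin
    Γ p pp s K i            ≡⟨ sum-map-upTo g (suc K) ⟩
    sumBelow (suc K) g      ≡⟨ sumBelow-vanish g (suc K) n g≡0-above-K ⟨
    sumBelow (suc K + n) g  ≡⟨ cong (λ m → sumBelow m g) (+-comm (suc K) n) ⟩
    sumBelow (n + suc K) g  ≡⟨ sumBelow-vanish g n (suc K) g≡0-from-n ⟩
    sumBelow n g            ≡⟨ sumBelow-cong n (λ j<n → cong (if _ then_else 0) (digit-fromDigits D<p j<n)) ⟩
    sumBelow n (λ j → if j % s ≡ᵇ toℕ i then D j else 0) ∎
    where
      open ≡-Reasoning
      K = fromDigits D n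
      g : ℕ → ℕ
      g j = if j % s ≡ᵇ toℕ i then digit p j K else 0
      g≡0-above-K : ∀ {j} → suc K ≤ j → g j ≡ 0
      g≡0-above-K {j} K<j = if-vanish (j % s ≡ᵇ toℕ i) (digit-< j (<-≤-trans K<j (<⇒≤ (n<p^n j))))
      g≡0-from-n : ∀ {j} → n ≤ j → g j ≡ 0
      g≡0-from-n {j} n≤j = if-vanish (j % s ≡ᵇ toℕ i) (digit-fromDigits-≥ D<p n≤j)

  count-blockDigits : ∀ w {i} → i < s → ∀ B → w i ≤ B →
                      sumBelow (B * s) (λ j → if j % s ≡ᵇ i then blockDigits w j else 0) ≡ w i
  count-blockDigits w {i} i<s zero    wᵢ≤0   = sym (n≤0⇒n≡0 wᵢ≤0)
  count-blockDigits w {i} i<s (suc B) wᵢ≤1+B = begin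
    sumBelow (s + B * s) g                             ≡⟨ sumBelow-+ g s (B * s) ⟩
    sumBelow s g + sumBelow (B * s) (λ j → g (s + j))  ≡⟨ cong₂ _+_ first-block later-blocks ⟩
    positive? (w i) + (w i ∸ 1)                        ≡⟨ positive?+pred (w i) ⟩
    w i                                                ∎
    where
      open ≡-Reasoning
      g : ℕ → ℕ
      g j = if j % s ≡ᵇ i then blockDigits w j else 0
      first-block : sumBelow s g ≡ positive? (w i)
      first-block = trans
        (sumBelow-cong s λ j<s → cong₂ (λ r x → if r ≡ᵇ i then x else 0)
                                       (m<n⇒m%n≡m j<s) (blockDigits-first w j<s))
        (sumBelow-select (positive? ∘ w) i<s)
      later-blocks : sumBelow (B * s) (λ j → g (s + j)) ≡ w i ∸ 1
      later-blocks = trans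
        (sumBelow-cong (B * s) λ {j} _ → cong₂ (λ r x → if r ≡ᵇ i then x else 0)
                                               ([s+j]%s≡j%s j) (blockDigits-shift w j))
        (count-blockDigits ((_∸ 1) ∘ w) i<s B (∸-monoˡ-≤ 1 wᵢ≤1+B))

  -- pˢ ≡ 1 modulo pˢ − 1, so every block of s digits contributes its own value.
  fromDigits-blockDigits : ∀ w B → (∀ {i} → i < s → w i ≤ B) →
                           ∃ λ q → fromDigits (blockDigits w) (B * s) ≡ fromDigits w s + p^s∸1 * q
  fromDigits-blockDigits w zero    w≤0   = 0 , sym (begin
    fromDigits w s + p^s∸1 * 0  ≡⟨ cong₂ _+_ (fromDigits-cong s (n≤0⇒n≡0 ∘ w≤0)) (*-zeroʳ p^s∸1) ⟩
    fromDigits (λ _ → 0) s + 0  ≡⟨ cong (_+ 0) (fromDigits-zero s) ⟩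
    0                           ∎)
    where open ≡-Reasoning
  fromDigits-blockDigits w (suc B) w≤1+B = F′ + p ^ s * q , (begin
    fromDigits (blockDigits w) (s + B * s)
      ≡⟨ fromDigits-+ (blockDigits w) s (B * s) ⟩
    fromDigits (blockDigits w) s + p ^ s * fromDigits (λ j → blockDigits w (s + j)) (B * s)
      ≡⟨ cong₂ (λ x y → x + p ^ s * y) (fromDigits-cong s (blockDigits-first w))
                                       (trans (fromDigits-cong (B * s) λ {j} _ → blockDigits-shift w j) F′-blocks) ⟩
    F₀ + p ^ s * (F′ + p^s∸1 * q)
      ≡⟨ cong (λ P → F₀ + P * (F′ + p^s∸1 * q)) p^s≡1+p^s∸1 ⟩
    F₀ + (1 + p^s∸1) * (F′ + p^s∸1 * q)
      ≡⟨ solve 4 (λ F₀ F′ N q → F₀ :+ (con 1 :+ N) :* (F′ :+ N :* q)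
                              := (F₀ :+ F′) :+ N :* (F′ :+ (con 1 :+ N) :* q)) refl F₀ F′ p^s∸1 q ⟩
    (F₀ + F′) + p^s∸1 * (F′ + (1 + p^s∸1) * q)
      ≡⟨ cong₂ (λ x P → x + p^s∸1 * (F′ + P * q)) F₀+F′≡F (sym p^s≡1+p^s∸1) ⟩
    fromDigits w s + p^s∸1 * (F′ + p ^ s * q)
      ∎)
    where
      open ≡-Reasoning
      IH = fromDigits-blockDigits ((_∸ 1) ∘ w) B (∸-monoˡ-≤ 1 ∘ w≤1+B)
      q = proj₁ IH
      F′-blocks = proj₂ IH
      F₀ = fromDigits (positive? ∘ w) s
      F′ = fromDigits ((_∸ 1) ∘ w) s
      F₀+F′≡F : F₀ + F′ ≡ fromDigits w s
      F₀+F′≡F = trans (sym (fromDigits-distrib-+ (positive? ∘ w) ((_∸ 1) ∘ w) s))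
                      (fromDigits-cong s λ {i} _ → positive?+pred (w i))

  In𝔍-intro : ∀ w {a} → 1 ≤ a → fromDigits w s ≡ p^s∸1 * a → In𝔍 p pp s (w ∘ toℕ)
  In𝔍-intro w {a} 1≤a F≡p^s∸1*a = K , 0<K , divides (a + q) K≡[a+q]*p^s∸1 , Γ-K
    where
      B = fromDigits w s
      K = fromDigits (blockDigits w) (B * s)
      K-spec = fromDigits-blockDigits w B (≤-fromDigits w)
      q = proj₁ K-spec
      K≡[a+q]*p^s∸1 : K ≡ (a + q) * p^s∸1
      K≡[a+q]*p^s∸1 = begin
        K                      ≡⟨ proj₂ K-spec ⟩
        B + p^s∸1 * q          ≡⟨ cong (_+ p^s∸1 * q) F≡p^s∸1*a ⟩
        p^s∸1 * a + p^s∸1 * q  ≡⟨ *-distribˡ-+ p^s∸1 a q ⟨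
        p^s∸1 * (a + q)        ≡⟨ *-comm p^s∸1 (a + q) ⟩
        (a + q) * p^s∸1        ∎
        where open ≡-Reasoning
      1≤p^s∸1 : 1 ≤ p^s∸1
      1≤p^s∸1 = ≤-pred (subst (1 <_) p^s≡1+p^s∸1 (^-monoʳ-< p 1<p (>-nonZero⁻¹ s)))
      0<K : 0 < K
      0<K = subst (0 <_) (sym K≡[a+q]*p^s∸1) (*-mono-≤ (≤-trans 1≤a (m≤m+n a q)) 1≤p^s∸1)
      Γ-K : ∀ i → Γ p pp s K i ≡ w (toℕ i)
      Γ-K i = trans (Γ-fromDigits (blockDigits<p w) (B * s) i)
                    (count-blockDigits w (toℕ<n i) B (≤-fromDigits w (toℕ<n i)))

module Rationals where

  open import Data.Integer as ℤ using (ℤ; +_; +<+; +≤+)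
  import Data.Integer.Properties as ℤ
  open import Data.Nat as ℕ using (ℕ; suc; z<s)
  import Data.Nat.Properties as ℕ
  open import Data.Nat.Coprimality using (1-coprimeTo) renaming (sym to coprime-sym)
  open import Data.Nat.DivMod using (m≡m%n+[m/n]*n; m%n<n; m/n*n≤m)
  open import Data.Product using (∃; _×_; _,_)
  open import Data.Rational as ℚ using (ℚ; mkℚ; 0ℚ; 1ℚ; _+_; _*_; _-_; -_; _≤_; _<_; *≤*; *<*)
  import Data.Rational.Properties as ℚ
  open import Data.Rational.Solver using (module +-*-Solver)
  open import Data.Rational.Unnormalised.Base using (*≡*)
  import Data.Rational.Unnormalised.Properties as ℚᵘ
  open import Relation.Binary.PropositionalEquality
  open import Defs using (ι)
  open +-*-Solver using (solve; _:*_; _:-_; _:=_; con)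

  ιℤ : ℤ → ℚ
  ιℤ z = mkℚ z 0 (coprime-sym (1-coprimeTo _))

  ι≡ιℤ : ∀ n → ι n ≡ ιℤ (+ n)
  ι≡ιℤ n = ℚ.↥p/↧p≡p (ιℤ (+ n))

  ιℤ-+ : ∀ x y → ιℤ (x ℤ.+ y) ≡ ιℤ x + ιℤ y
  ιℤ-+ x y = ℚ.toℚᵘ-injective (ℚᵘ.≃-sym (ℚᵘ.≃-trans (ℚ.toℚᵘ-homo-+ (ιℤ x) (ιℤ y)) (*≡* x*1+y*1≡x+y)))
    where
      open ≡-Reasoning
      x*1+y*1≡x+y : (x ℤ.* + 1 ℤ.+ y ℤ.* + 1) ℤ.* + 1 ≡ (x ℤ.+ y) ℤ.* + 1
      x*1+y*1≡x+y = begin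
        (x ℤ.* + 1 ℤ.+ y ℤ.* + 1) ℤ.* + 1  ≡⟨ ℤ.*-identityʳ _ ⟩
        x ℤ.* + 1 ℤ.+ y ℤ.* + 1            ≡⟨ cong₂ ℤ._+_ (ℤ.*-identityʳ x) (ℤ.*-identityʳ y) ⟩
        x ℤ.+ y                            ≡⟨ ℤ.*-identityʳ (x ℤ.+ y) ⟨
        (x ℤ.+ y) ℤ.* + 1                  ∎

  ιℤ-* : ∀ x y → ιℤ (x ℤ.* y) ≡ ιℤ x * ιℤ y
  ιℤ-* x y = ℚ.toℚᵘ-injective (ℚᵘ.≃-sym (ℚᵘ.≃-trans (ℚ.toℚᵘ-homo-* (ιℤ x) (ιℤ y)) (*≡* refl)))

  ιℤ-neg : ∀ x → ιℤ (ℤ.- x) ≡ - ιℤ x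
  ιℤ-neg (+ ℕ.zero)  = refl
  ιℤ-neg ℤ.+[1+ n ]  = refl
  ιℤ-neg ℤ.-[1+ n ]  = refl

  ιℤ-- : ∀ x y → ιℤ (x ℤ.- y) ≡ ιℤ x - ιℤ y
  ιℤ-- x y = trans (ιℤ-+ x (ℤ.- y)) (cong (λ q → ιℤ x + q) (ιℤ-neg y))

  ιℤ-cancel-≤ : ∀ {x y} → ιℤ x ≤ ιℤ y → x ℤ.≤ y
  ιℤ-cancel-≤ {x} {y} (*≤* x*1≤y*1) = subst₂ ℤ._≤_ (ℤ.*-identityʳ x) (ℤ.*-identityʳ y) x*1≤y*1

  ι-+ : ∀ m n → ι (m ℕ.+ n) ≡ ι m + ι n
  ι-+ m n = begin
    ι (m ℕ.+ n)          ≡⟨ ι≡ιℤ (m ℕ.+ n) ⟩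
    ιℤ (+ m ℤ.+ + n)     ≡⟨ ιℤ-+ (+ m) (+ n) ⟩
    ιℤ (+ m) + ιℤ (+ n)  ≡⟨ cong₂ _+_ (ι≡ιℤ m) (ι≡ιℤ n) ⟨
    ι m + ι n            ∎
    where open ≡-Reasoning

  ι-* : ∀ m n → ι (m ℕ.* n) ≡ ι m * ι n
  ι-* m n = begin
    ι (m ℕ.* n)          ≡⟨ ι≡ιℤ (m ℕ.* n) ⟩
    ιℤ (+ (m ℕ.* n))     ≡⟨ cong ιℤ (ℤ.pos-* m n) ⟩
    ιℤ (+ m ℤ.* + n)     ≡⟨ ιℤ-* (+ m) (+ n) ⟩
    ιℤ (+ m) * ιℤ (+ n)  ≡⟨ cong₂ _*_ (ι≡ιℤ m) (ι≡ιℤ n) ⟨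
    ι m * ι n            ∎
    where open ≡-Reasoning

  ι-mono-≤ : ∀ {m n} → m ℕ.≤ n → ι m ≤ ι n
  ι-mono-≤ {m} {n} m≤n = subst₂ _≤_ (sym (ι≡ιℤ m)) (sym (ι≡ιℤ n))
    (*≤* (subst₂ ℤ._≤_ (sym (ℤ.*-identityʳ (+ m))) (sym (ℤ.*-identityʳ (+ n))) (+≤+ m≤n)))

  ι-mono-< : ∀ {m n} → m ℕ.< n → ι m < ι n
  ι-mono-< {m} {n} m<n = subst₂ _<_ (sym (ι≡ιℤ m)) (sym (ι≡ιℤ n))
    (*<* (subst₂ ℤ._<_ (sym (ℤ.*-identityʳ (+ m))) (sym (ℤ.*-identityʳ (+ n))) (+<+ m<n)))

  ι-cancel-< : ∀ {m n} → ι m < ι n → m ℕ.< n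
  ι-cancel-< {m} {n} ιm<ιn with subst₂ _<_ (ι≡ιℤ m) (ι≡ιℤ n) ιm<ιn
  ... | *<* m*1<n*1 = ℤ.drop‿+<+ (subst₂ ℤ._<_ (ℤ.*-identityʳ (+ m)) (ℤ.*-identityʳ (+ n)) m*1<n*1)

  -- For q = n / d the witness is a = (n ∸ 1) div d, that is ⌈q⌉ − 1.
  ∃-ι-<-≤-ι-suc : ∀ q → 0ℚ < q → ∃ λ a → ι a < q × q ≤ ι (suc a)
  ∃-ι-<-≤-ι-suc (mkℚ ℤ.-[1+ _ ] _ _) (*<* ())
  ∃-ι-<-≤-ι-suc q@(mkℚ (+ n) d-1 _) (*<* 0<n*1) = a , ιa<q , q≤ι[1+a]
    where
      d = suc d-1
      a = (n ℕ.∸ 1) ℕ./ d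
      0<n : 0 ℕ.< n
      0<n = ℤ.drop‿+<+ (subst (+ 0 ℤ.<_) (ℤ.*-identityʳ (+ n)) 0<n*1)
      a*d<n : a ℕ.* d ℕ.< n
      a*d<n = ℕ.≤-<-trans (m/n*n≤m (n ℕ.∸ 1) d) (ℕ.∸-monoʳ-< z<s 0<n)
      n≤[1+a]*d : n ℕ.≤ suc a ℕ.* d
      n≤[1+a]*d = subst (ℕ._≤ suc a ℕ.* d) (ℕ.m+[n∸m]≡n 0<n)
        (subst (ℕ._< suc a ℕ.* d) (sym (m≡m%n+[m/n]*n (n ℕ.∸ 1) d))
          (ℕ.+-monoˡ-< (a ℕ.* d) (m%n<n (n ℕ.∸ 1) d)))
      ιa<q : ι a < q
      ιa<q = subst (_< q) (sym (ι≡ιℤ a))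
        (*<* (subst₂ ℤ._<_ (ℤ.pos-* a d) (sym (ℤ.*-identityʳ (+ n))) (+<+ a*d<n)))
      q≤ι[1+a] : q ≤ ι (suc a)
      q≤ι[1+a] = subst (q ≤_) (sym (ι≡ιℤ (suc a)))
        (*≤* (subst₂ ℤ._≤_ (sym (ℤ.*-identityʳ (+ n))) (ℤ.pos-* (suc a) d) (+≤+ n≤[1+a]*d)))

  x-1*[x-a]≡a : ∀ a x → x - 1ℚ * (x - a) ≡ a
  x-1*[x-a]≡a = solve 2 (λ a x → x :- con 1ℚ :* (x :- a) := a) refl

  x-p[y-a]≤a : ∀ {a x y} P → x ≤ y → a ≤ y → 1ℚ ≤ P → x - P * (y - a) ≤ a
  x-p[y-a]≤a {a} {x} {y} P x≤y a≤y 1≤P = subst (x - P * (y - a) ≤_) (x-1*[x-a]≡a a y)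
    (ℚ.+-mono-≤ x≤y (ℚ.neg-antimono-≤ (ℚ.*-monoʳ-≤-nonNeg (y - a) {{ℚ.nonNegative 0≤y-a}} 1≤P)))
    where
      0≤y-a : 0ℚ ≤ y - a
      0≤y-a = subst (_≤ y - a) (ℚ.+-inverseʳ a) (ℚ.+-monoˡ-≤ (- a) a≤y)

  x-p[x-a]<a : ∀ {a x} P → a < x → 1ℚ < P → x - P * (x - a) < a
  x-p[x-a]<a {a} {x} P a<x 1<P = subst (x - P * (x - a) <_) (x-1*[x-a]≡a a x)
    (ℚ.+-monoʳ-< x (ℚ.neg-antimono-< (ℚ.*-monoˡ-<-pos (x - a) {{ℚ.positive 0<x-a}} 1<P)))
    where
      0<x-a : 0ℚ < x - a
      0<x-a = subst (_< x - a) (ℚ.+-inverseʳ a) (ℚ.+-monoˡ-< (- a) a<x)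

module ActionOfE where

  open import Data.Bool using (Bool; true; false; if_then_else_; T)
  open import Data.Empty using (⊥-elim)
  open import Data.Fin as Fin using (Fin; toℕ)
  open import Data.Fin.Properties using (toℕ-injective; toℕ-fromℕ<; toℕ<n; 0≢1+n; suc-injective)
  open import Data.Nat as ℕ using (ℕ; zero; suc; _%_; _≡ᵇ_)
  import Data.Nat.Properties as ℕ
  open import Data.Nat.DivMod using (_mod_; m%n<n; %-distribˡ-+; m%n%n≡m%n; [m+n]%n≡m%n; m<n⇒m%n≡m)
  open import Data.Rational as ℚ using (ℚ; 0ℚ; 1ℚ; _+_; _*_; _-_)
  import Data.Rational.Properties as ℚ
  open import Data.Rational.Solver using (module +-*-Solver)
  open import Function using (_∘_)
  open import Relation.Binary.PropositionalEquality
  open import Relation.Nullary using (¬_)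
  open import Defs using (ι; Σ; predMod; Emul)
  open +-*-Solver using (solve; _:+_; _:*_; _:-_; _:=_)

  δ : Bool → ℚ
  δ b = if b then 1ℚ else 0ℚ

  δ-true : ∀ {b} → T b → δ b ≡ 1ℚ
  δ-true {true} _ = refl

  δ-false : ∀ {b} → ¬ T b → δ b ≡ 0ℚ
  δ-false {true}  ¬true = ⊥-elim (¬true _)
  δ-false {false} _     = refl

  Σ-linear : ∀ {n} (x A B : Fin n → ℚ) α →
             Σ (λ i → x i * (α * A i - B i)) ≡ α * Σ (λ i → x i * A i) - Σ (λ i → x i * B i)
  Σ-linear {zero}  x A B α = sym (trans (cong (_- 0ℚ) (ℚ.*-zeroʳ α)) (ℚ.+-inverseʳ 0ℚ))
  Σ-linear {suc n} x A B α rewrite Σ-linear (x ∘ Fin.suc) (A ∘ Fin.suc) (B ∘ Fin.suc) α =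
    solve 6 (λ x₀ a₀ b₀ α ΣA ΣB → x₀ :* (α :* a₀ :- b₀) :+ (α :* ΣA :- ΣB)
                                := α :* (x₀ :* a₀ :+ ΣA) :- (x₀ :* b₀ :+ ΣB))
      refl (x Fin.zero) (A Fin.zero) (B Fin.zero) α
      (Σ (λ i → x (Fin.suc i) * A (Fin.suc i))) (Σ (λ i → x (Fin.suc i) * B (Fin.suc i)))

  Σ-δ-nowhere : ∀ {n} (x : Fin n → ℚ) (P : Fin n → Bool) → (∀ i → ¬ T (P i)) →
                Σ (λ i → x i * δ (P i)) ≡ 0ℚ
  Σ-δ-nowhere {zero}  x P ¬P = refl
  Σ-δ-nowhere {suc n} x P ¬P = begin
    x Fin.zero * δ (P Fin.zero) + Σ (λ i → x (Fin.suc i) * δ (P (Fin.suc i)))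
      ≡⟨ cong₂ _+_ (cong (x Fin.zero *_) (δ-false (¬P Fin.zero)))
                   (Σ-δ-nowhere (x ∘ Fin.suc) (P ∘ Fin.suc) (¬P ∘ Fin.suc)) ⟩
    x Fin.zero * 0ℚ + 0ℚ
      ≡⟨ cong (_+ 0ℚ) (ℚ.*-zeroʳ (x Fin.zero)) ⟩
    0ℚ
      ∎
    where open ≡-Reasoning

  Σ-δ-select : ∀ {n} (x : Fin n → ℚ) (P : Fin n → Bool) {i₀} →
               (∀ i → T (P i) → i ≡ i₀) → T (P i₀) → Σ (λ i → x i * δ (P i)) ≡ x i₀
  Σ-δ-select {suc n} x P {Fin.zero} only-i₀ Pi₀ = begin
    x Fin.zero * δ (P Fin.zero) + Σ (λ i → x (Fin.suc i) * δ (P (Fin.suc i)))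
      ≡⟨ cong₂ _+_ (cong (x Fin.zero *_) (δ-true Pi₀))
                   (Σ-δ-nowhere (x ∘ Fin.suc) (P ∘ Fin.suc) λ i Pi → 0≢1+n (sym (only-i₀ (Fin.suc i) Pi))) ⟩
    x Fin.zero * 1ℚ + 0ℚ
      ≡⟨ trans (ℚ.+-identityʳ _) (ℚ.*-identityʳ _) ⟩
    x Fin.zero
      ∎
    where open ≡-Reasoning
  Σ-δ-select {suc n} x P {Fin.suc i₀} only-i₀ Pi₀ = begin
    x Fin.zero * δ (P Fin.zero) + Σ (λ i → x (Fin.suc i) * δ (P (Fin.suc i)))
      ≡⟨ cong₂ _+_ (cong (x Fin.zero *_) (δ-false λ P0 → 0≢1+n (only-i₀ Fin.zero P0)))
                   (Σ-δ-select (x ∘ Fin.suc) (P ∘ Fin.suc) (λ i → suc-injective ∘ only-i₀ (Fin.suc i)) Pi₀) ⟩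
    x Fin.zero * 0ℚ + x (Fin.suc i₀)
      ≡⟨ trans (cong (_+ x (Fin.suc i₀)) (ℚ.*-zeroʳ (x Fin.zero))) (ℚ.+-identityˡ _) ⟩
    x (Fin.suc i₀)
      ∎
    where open ≡-Reasoning

  next : ∀ {k} → Fin (suc k) → Fin (suc k)
  next {k} j = suc (toℕ j) mod suc k

  toℕ-next : ∀ {k} (j : Fin (suc k)) → toℕ (next j) ≡ suc (toℕ j) % suc k
  toℕ-next {k} j = toℕ-fromℕ< (m%n<n (suc (toℕ j)) (suc k))

  [m+n%o]%o≡[m+n]%o : ∀ m n o .{{_ : ℕ.NonZero o}} → (m ℕ.+ n % o) % o ≡ (m ℕ.+ n) % o
  [m+n%o]%o≡[m+n]%o m n o = begin
    (m ℕ.+ n % o) % o          ≡⟨ %-distribˡ-+ m (n % o) o ⟩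
    (m % o ℕ.+ n % o % o) % o  ≡⟨ cong (λ r → (m % o ℕ.+ r) % o) (m%n%n≡m%n n o) ⟩
    (m % o ℕ.+ n % o) % o      ≡⟨ %-distribˡ-+ m n o ⟨
    (m ℕ.+ n) % o              ∎
    where open ≡-Reasoning

  predMod-next : ∀ {k} (j : Fin (suc k)) → predMod (suc k) (next j) ≡ toℕ j
  predMod-next {k} j = begin
    (toℕ (next j) ℕ.+ k) % suc k         ≡⟨ cong (λ r → (r ℕ.+ k) % suc k) (toℕ-next j) ⟩
    (suc (toℕ j) % suc k ℕ.+ k) % suc k  ≡⟨ cong (_% suc k) (ℕ.+-comm _ k) ⟩
    (k ℕ.+ suc (toℕ j) % suc k) % suc k  ≡⟨ [m+n%o]%o≡[m+n]%o k (suc (toℕ j)) (suc k) ⟩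
    (k ℕ.+ suc (toℕ j)) % suc k          ≡⟨ cong (_% suc k) (ℕ.+-suc k (toℕ j)) ⟩
    suc (k ℕ.+ toℕ j) % suc k            ≡⟨ cong (_% suc k) (ℕ.+-comm (suc k) (toℕ j)) ⟩
    (toℕ j ℕ.+ suc k) % suc k            ≡⟨ [m+n]%n≡m%n (toℕ j) (suc k) ⟩
    toℕ j % suc k                        ≡⟨ m<n⇒m%n≡m (toℕ<n j) ⟩
    toℕ j                                ∎
    where open ≡-Reasoning

  suc-predMod : ∀ {k} (i : Fin (suc k)) → suc (predMod (suc k) i) % suc k ≡ toℕ i
  suc-predMod {k} i = begin
    (1 ℕ.+ (toℕ i ℕ.+ k) % suc k) % suc k  ≡⟨ [m+n%o]%o≡[m+n]%o 1 (toℕ i ℕ.+ k) (suc k) ⟩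
    suc (toℕ i ℕ.+ k) % suc k              ≡⟨ cong (_% suc k) (ℕ.+-suc (toℕ i) k) ⟨
    (toℕ i ℕ.+ suc k) % suc k              ≡⟨ [m+n]%n≡m%n (toℕ i) (suc k) ⟩
    toℕ i % suc k                          ≡⟨ m<n⇒m%n≡m (toℕ<n i) ⟩
    toℕ i                                  ∎
    where open ≡-Reasoning

  Emul-next : ∀ p {k} (x : Fin (suc k) → ℚ) j → Emul p (suc k) x j ≡ ι p * x (next j) - x j
  Emul-next p {k} x j = trans (Σ-linear x (δ ∘ j≡ᵇpredMod) (δ ∘ j≡ᵇ) (ι p))
    (cong₂ (λ a b → ι p * a - b)
      (Σ-δ-select x j≡ᵇpredMod only-next (ℕ.≡⇒≡ᵇ _ _ (sym (predMod-next j))))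
      (Σ-δ-select x j≡ᵇ (λ i j≡i → toℕ-injective (sym (ℕ.≡ᵇ⇒≡ _ _ j≡i))) (ℕ.≡⇒≡ᵇ (toℕ j) _ refl)))
    where
      j≡ᵇpredMod j≡ᵇ : Fin (suc k) → Bool
      j≡ᵇpredMod i = toℕ j ≡ᵇ predMod (suc k) i
      j≡ᵇ        i = toℕ j ≡ᵇ toℕ i
      only-next : ∀ i → T (toℕ j ≡ᵇ predMod (suc k) i) → i ≡ next j
      only-next i j≡i-1 = toℕ-injective (begin
        toℕ i                            ≡⟨ suc-predMod i ⟨
        suc (predMod (suc k) i) % suc k  ≡⟨ cong (λ r → suc r % suc k) (ℕ.≡ᵇ⇒≡ _ _ j≡i-1) ⟨
        suc (toℕ j) % suc k              ≡⟨ toℕ-next j ⟨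
        toℕ (next j)                     ∎)
        where open ≡-Reasoning

module Maximum where

  open import Data.Integer as ℤ using (ℤ)
  import Data.Integer.Properties as ℤ
  open import Data.Nat as ℕ using (ℕ; zero; suc; z≤n; s≤s)
  import Data.Nat.Properties as ℕ
  open import Data.Product using (∃; _×_; _,_)
  open import Data.Sum using (inj₁; inj₂)
  open import Relation.Binary.PropositionalEquality

  maxUpTo : ℕ → (ℕ → ℤ) → ℤ
  maxUpTo zero    f = f 0
  maxUpTo (suc M) f = maxUpTo M f ℤ.⊔ f (suc M)

  ≤-maxUpTo : ∀ f {m} M → m ℕ.≤ M → f m ℤ.≤ maxUpTo M f
  ≤-maxUpTo f {zero} zero    _   = ℤ.≤-refl
  ≤-maxUpTo f        (suc M) m≤M with ℕ.m≤n⇒m<n∨m≡n m≤M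
  ... | inj₁ (s≤s m≤M′) = ℤ.≤-trans (≤-maxUpTo f M m≤M′) (ℤ.i≤i⊔j _ _)
  ... | inj₂ refl       = ℤ.i≤j⊔i _ _

  maxUpTo-attained : ∀ f M → ∃ λ m → m ℕ.≤ M × maxUpTo M f ≡ f m
  maxUpTo-attained f zero    = 0 , z≤n , refl
  maxUpTo-attained f (suc M) with ℤ.⊔-sel (maxUpTo M f) (f (suc M))
  ... | inj₂ ≡f[1+M] = suc M , ℕ.≤-refl , ≡f[1+M]
  ... | inj₁ ≡max with maxUpTo-attained f M
  ...   | m , m≤M , ≡fm = m , ℕ.m≤n⇒m≤1+n m≤M , trans ≡max ≡fm

  maxUpTo-cong : ∀ {f g} M → (∀ m → f m ≡ g m) → maxUpTo M f ≡ maxUpTo M g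
  maxUpTo-cong zero    f≗g = f≗g 0
  maxUpTo-cong (suc M) f≗g = cong₂ ℤ._⊔_ (maxUpTo-cong M f≗g) (f≗g (suc M))

open import Defs
open import Data.Nat using (ℕ; suc)
open import Data.Nat.Primality using (Prime)
open import Data.Fin using (Fin; zero)
open import Data.Product using (∃; _×_; _,_)
open import Data.Rational using (ℚ; _<_; _≤_; _-_; 1ℚ)
open import Relation.Binary.PropositionalEquality using (_≡_)

module Construction (p : ℕ) (pp : Prime p) (k : ℕ) (c : Fin (suc k) → ℚ) (v : Fin (suc k) → ℕ)
  (Ec≡v : ∀ j → Emul p (suc k) c j ≡ ι (v j)) (1<c₀ : 1ℚ < c zero) (c₀≤c : ∀ i → c zero ≤ c i) where

  open import Data.Fin using (toℕ)
  open import Data.Fin.Properties using (toℕ-injective; toℕ-fromℕ<; toℕ<n)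
  open import Data.Integer as ℤ using (ℤ; +_; +≤+)
  import Data.Integer.Properties as ℤ
  open import Data.Nat as ℕ using (z≤n; s≤s; z<s; _%_; _^_)
  import Data.Nat.Properties as ℕ
  open import Data.Nat.DivMod using (_mod_; m%n<n; m%n%n≡m%n; [m+n]%n≡m%n; m<n⇒m%n≡m)
  open import Data.Product using (proj₁; proj₂)
  open import Data.Rational using (_+_; _*_; -_)
  import Data.Rational.Properties as ℚ
  open import Data.Rational.Solver using (module +-*-Solver)
  open import Data.Sum using (inj₁; inj₂)
  open import Function using (_∘_)
  open import Relation.Binary.PropositionalEquality
  open import Relation.Nullary using (¬_)
  open +-*-Solver using (solve; _:+_; _:*_; _:-_; _:=_; con)
  open Rationals
  open ActionOfE using (next; [m+n%o]%o≡[m+n]%o; Emul-next)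
  open Maximum

  s : ℕ
  s = suc k

  open Realisation p pp s using (p-nonTrivial; p^s∸1; In𝔍-intro)
  open Digits p using (p≢0; 1<p; fromDigits; fromDigits-telescope)

  fin : ℕ → Fin s
  fin n = n mod s

  toℕ-fin : ∀ n → toℕ (fin n) ≡ n % s
  toℕ-fin n = toℕ-fromℕ< (m%n<n n s)

  fin-cong : ∀ {n n′} → n % s ≡ n′ % s → fin n ≡ fin n′
  fin-cong {n} {n′} eq = toℕ-injective (trans (toℕ-fin n) (trans eq (sym (toℕ-fin n′))))

  fin-toℕ : ∀ i → fin (toℕ i) ≡ i
  fin-toℕ i = toℕ-injective (trans (toℕ-fin (toℕ i)) (m<n⇒m%n≡m (toℕ<n i)))

  toℕ-fin-mod : ∀ n → toℕ (fin n) % s ≡ n % s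
  toℕ-fin-mod n = trans (cong (_% s) (toℕ-fin n)) (m%n%n≡m%n n s)

  suc-cong-mod : ∀ {n n′} → n % s ≡ n′ % s → suc n % s ≡ suc n′ % s
  suc-cong-mod {n} {n′} eq = begin
    suc n % s           ≡⟨ [m+n%o]%o≡[m+n]%o 1 n s ⟨
    (1 ℕ.+ n % s) % s   ≡⟨ cong (λ r → (1 ℕ.+ r) % s) eq ⟩
    (1 ℕ.+ n′ % s) % s  ≡⟨ [m+n%o]%o≡[m+n]%o 1 n′ s ⟩
    suc n′ % s          ∎
    where open ≡-Reasoning

  next-fin : ∀ n → next (fin n) ≡ fin (suc n)
  next-fin n = fin-cong {suc (toℕ (fin n))} {suc n} (suc-cong-mod {toℕ (fin n)} {n} (toℕ-fin-mod n))

  -- Vectors on Fin s are handled as s-periodic sequences on ℕ (c′, v′, d, wℕ); d̂ and ŵ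
  -- restrict the constructed sequences back to Fin s.
  c′ : ℕ → ℚ
  c′ n = c (fin n)

  v′ : ℕ → ℕ
  v′ n = v (fin n)

  Ec′≡v′ : ∀ n → ι (v′ n) ≡ ι p * c′ (suc n) - c′ n
  Ec′≡v′ n = begin
    ι (v′ n)                       ≡⟨ Ec≡v (fin n) ⟨
    Emul p s c (fin n)             ≡⟨ Emul-next p c (fin n) ⟩
    ι p * c (next (fin n)) - c′ n  ≡⟨ cong (λ j → ι p * c j - c′ n) (next-fin n) ⟩
    ι p * c′ (suc n) - c′ n        ∎
    where open ≡-Reasoning

  a-spec : ∃ λ a → ι a < c zero × c zero ≤ ι (suc a)
  a-spec = ∃-ι-<-≤-ι-suc (c zero) (ℚ.<-trans (ℚ.positive⁻¹ 1ℚ) 1<c₀)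

  a : ℕ
  a = proj₁ a-spec

  ιa<c₀ : ι a < c zero
  ιa<c₀ = proj₁ (proj₂ a-spec)

  c₀-1≤ιa : c zero - 1ℚ ≤ ι a
  c₀-1≤ιa = subst (c zero - 1ℚ ≤_) ι[1+a]-1≡ιa (ℚ.+-monoˡ-≤ (- 1ℚ) (proj₂ (proj₂ a-spec)))
    where
      ι[1+a]-1≡ιa : ι (suc a) - 1ℚ ≡ ι a
      ι[1+a]-1≡ιa = trans (cong (_- 1ℚ) (ι-+ 1 a))
                          (solve 1 (λ x → (con 1ℚ :+ x) :- con 1ℚ := x) refl (ι a))

  1≤a : 1 ℕ.≤ a
  1≤a = ℕ.≤-pred (ι-cancel-< (ℚ.<-≤-trans 1<c₀ (proj₂ (proj₂ a-spec))))

  ιa≤c′ : ∀ n → ι a ≤ c′ n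
  ιa≤c′ n = ℚ.≤-trans (ℚ.<⇒≤ ιa<c₀) (c₀≤c (fin n))

  1≤ι[p^m] : ∀ m → 1ℚ ≤ ι (p ^ m)
  1≤ι[p^m] m = ι-mono-≤ (ℕ.m^n>0 p m)

  anchored : ℕ → ℕ → ℤ
  anchored ℕ.zero  n = + a
  anchored (suc m) n = + p ℤ.* anchored m (suc n) ℤ.- + v′ n

  ιℤ-anchored : (x : ℕ → ℚ) → (∀ n → ι (v′ n) ≡ ι p * x (suc n) - x n) →
                ∀ m n → ιℤ (anchored m n) ≡ x n - ι (p ^ m) * (x (n ℕ.+ m) - ι a)
  ιℤ-anchored x Ex≡v′ ℕ.zero  n = begin
    ιℤ (+ a)                            ≡⟨ ι≡ιℤ a ⟨
    ι a                                 ≡⟨ x-1*[x-a]≡a (ι a) (x n) ⟨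
    x n - 1ℚ * (x n - ι a)              ≡⟨ cong (λ y → x n - 1ℚ * (x y - ι a)) (ℕ.+-identityʳ n) ⟨
    x n - ι (p ^ 0) * (x (n ℕ.+ 0) - ι a) ∎
    where open ≡-Reasoning
  ιℤ-anchored x Ex≡v′ (suc m) n = begin
    ιℤ (+ p ℤ.* t ℤ.- + v′ n)
      ≡⟨ ιℤ-- (+ p ℤ.* t) (+ v′ n) ⟩
    ιℤ (+ p ℤ.* t) - ιℤ (+ v′ n)
      ≡⟨ cong₂ _-_ (ιℤ-* (+ p) t) (sym (ι≡ιℤ (v′ n))) ⟩
    ιℤ (+ p) * ιℤ t - ι (v′ n)
      ≡⟨ cong₂ (λ P q → P * q - ι (v′ n)) (sym (ι≡ιℤ p)) (ιℤ-anchored x Ex≡v′ m (suc n)) ⟩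
    ι p * (x (suc n) - ι (p ^ m) * (x (suc n ℕ.+ m) - ι a)) - ι (v′ n)
      ≡⟨ cong₂ (λ r y → ι p * (x (suc n) - ι (p ^ m) * (x r - ι a)) - y)
               (sym (ℕ.+-suc n m)) (Ex≡v′ n) ⟩
    ι p * (x (suc n) - ι (p ^ m) * (x (n ℕ.+ suc m) - ι a)) - (ι p * x (suc n) - x n)
      ≡⟨ solve 6 (λ P Q x₀ x₁ y a → P :* (x₁ :- Q :* (y :- a)) :- (P :* x₁ :- x₀)
                                 := x₀ :- (P :* Q) :* (y :- a))
                 refl (ι p) (ι (p ^ m)) (x n) (x (suc n)) (x (n ℕ.+ suc m)) (ι a) ⟩
    x n - (ι p * ι (p ^ m)) * (x (n ℕ.+ suc m) - ι a)
      ≡⟨ cong (λ P → x n - P * (x (n ℕ.+ suc m) - ι a)) (sym (ι-* p (p ^ m))) ⟩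
    x n - ι (p ^ suc m) * (x (n ℕ.+ suc m) - ι a)
      ∎
    where
      open ≡-Reasoning
      t = anchored m (suc n)

  anchored-cong-mod : ∀ m {n n′} → n % s ≡ n′ % s → anchored m n ≡ anchored m n′
  anchored-cong-mod ℕ.zero  eq = refl
  anchored-cong-mod (suc m) {n} {n′} eq =
    cong₂ (λ t y → + p ℤ.* t ℤ.- + y) (anchored-cong-mod m (suc-cong-mod {n} {n′} eq))
                                      (cong v (fin-cong {n} {n′} eq))

  anchored-suc : ∀ m n → anchored (suc m) n ℤ.+ + v′ n ≡ + p ℤ.* anchored m (suc n)
  anchored-suc m n = begin
    (t ℤ.- + v′ n) ℤ.+ + v′ n       ≡⟨ ℤ.+-assoc t (ℤ.- + v′ n) (+ v′ n) ⟩
    t ℤ.+ (ℤ.- + v′ n ℤ.+ + v′ n)   ≡⟨ cong (λ u → t ℤ.+ u) (ℤ.+-inverseˡ (+ v′ n)) ⟩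
    t ℤ.+ + 0                       ≡⟨ ℤ.+-identityʳ t ⟩
    t                               ∎
    where
      open ≡-Reasoning
      t = + p ℤ.* anchored m (suc n)

  anchored[m,0]≤a : ∀ m → anchored m 0 ℤ.≤ + a
  anchored[m,0]≤a m = ιℤ-cancel-≤ (subst₂ _≤_ (sym (ιℤ-anchored c′ Ec′≡v′ m 0)) (ι≡ιℤ a)
    (x-p[y-a]≤a (ι (p ^ m)) (c₀≤c (fin m)) (ιa≤c′ m) (1≤ι[p^m] m)))

  anchored[s,n]≤a : ∀ n → anchored s n ℤ.≤ + a
  anchored[s,n]≤a n = ιℤ-cancel-≤ (subst₂ _≤_ (sym (ιℤ-anchored c′ Ec′≡v′ s n)) (ι≡ιℤ a)
    (subst (λ y → c′ n - ι (p ^ s) * (y - ι a) ≤ ι a) c′ₙ≡c′ₙ₊ₛ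
      (x-p[y-a]≤a (ι (p ^ s)) ℚ.≤-refl (ιa≤c′ n) (1≤ι[p^m] s))))
    where
      c′ₙ≡c′ₙ₊ₛ : c′ n ≡ c′ (n ℕ.+ s)
      c′ₙ≡c′ₙ₊ₛ = cong c (fin-cong {n} {n ℕ.+ s} (sym ([m+n]%n≡m%n n s)))

  d : ℕ → ℤ
  d n = maxUpTo k (λ m → anchored m n)

  a≤d : ∀ n → + a ℤ.≤ d n
  a≤d n = ≤-maxUpTo (λ m → anchored m n) k z≤n

  anchored≤d : ∀ {m} n → m ℕ.≤ s → anchored m n ℤ.≤ d n
  anchored≤d n m≤s with ℕ.m≤n⇒m<n∨m≡n m≤s
  ... | inj₁ (s≤s m≤k) = ≤-maxUpTo (λ m → anchored m n) k m≤k
  ... | inj₂ refl      = ℤ.≤-trans (anchored[s,n]≤a n) (a≤d n)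

  d₀≡a : d 0 ≡ + a
  d₀≡a with maxUpTo-attained (λ m → anchored m 0) k
  ... | m , _ , d₀≡anchored =
    ℤ.≤-antisym (subst (ℤ._≤ + a) (sym d₀≡anchored) (anchored[m,0]≤a m)) (a≤d 0)

  d-cong-mod : ∀ {n n′} → n % s ≡ n′ % s → d n ≡ d n′
  d-cong-mod eq = maxUpTo-cong k (λ m → anchored-cong-mod m eq)

  p*d[1+n]≤d+v : ∀ n → + p ℤ.* d (suc n) ℤ.≤ d n ℤ.+ + v′ n
  p*d[1+n]≤d+v n with maxUpTo-attained (λ m → anchored m (suc n)) k
  ... | m , m≤k , d[1+n]≡anchored = begin
    + p ℤ.* d (suc n)              ≡⟨ cong (+ p ℤ.*_) d[1+n]≡anchored ⟩
    + p ℤ.* anchored m (suc n)     ≡⟨ anchored-suc m n ⟨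
    anchored (suc m) n ℤ.+ + v′ n  ≤⟨ ℤ.+-monoˡ-≤ (+ v′ n) (anchored≤d n (s≤s m≤k)) ⟩
    d n ℤ.+ + v′ n                 ∎
    where open ℤ.≤-Reasoning

  d≤p*d[1+n] : ∀ n → d n ℤ.≤ + p ℤ.* d (suc n)
  d≤p*d[1+n] n with maxUpTo-attained (λ m → anchored m n) k
  ... | ℕ.zero , _ , dₙ≡a = begin
    d n                ≡⟨ dₙ≡a ⟩
    + a                ≤⟨ a≤d (suc n) ⟩
    d (suc n)          ≡⟨ ℤ.*-identityˡ (d (suc n)) ⟨
    + 1 ℤ.* d (suc n)  ≤⟨ ℤ.*-monoʳ-≤-nonNeg (d (suc n)) {{d[1+n]≥0}} (+≤+ (ℕ.<⇒≤ 1<p)) ⟩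
    + p ℤ.* d (suc n)  ∎
    where
      open ℤ.≤-Reasoning
      d[1+n]≥0 = ℤ.nonNegative (ℤ.≤-trans (+≤+ z≤n) (a≤d (suc n)))
  ... | suc m , 1+m≤k , dₙ≡anchored = begin
    d n                            ≡⟨ dₙ≡anchored ⟩
    anchored (suc m) n             ≤⟨ ℤ.i≤i+j _ (+ v′ n) ⟩
    anchored (suc m) n ℤ.+ + v′ n  ≡⟨ anchored-suc m n ⟩
    + p ℤ.* anchored m (suc n)     ≤⟨ ℤ.*-monoˡ-≤-nonNeg (+ p) (anchored≤d (suc n) (ℕ.m≤n⇒m≤1+n (ℕ.<⇒≤ 1+m≤k))) ⟩
    + p ℤ.* d (suc n)              ∎
    where open ℤ.≤-Reasoning

  dℕ : ℕ → ℕ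
  dℕ n = ℤ.∣ d n ∣

  +dℕ≡d : ∀ n → + dℕ n ≡ d n
  +dℕ≡d n = ℤ.0≤i⇒+∣i∣≡i (ℤ.≤-trans (+≤+ z≤n) (a≤d n))

  a≤dℕ : ∀ n → a ℕ.≤ dℕ n
  a≤dℕ n = ℤ.drop‿+≤+ (subst (+ a ℤ.≤_) (sym (+dℕ≡d n)) (a≤d n))

  dℕ₀≡a : dℕ 0 ≡ a
  dℕ₀≡a = cong ℤ.∣_∣ d₀≡a

  dℕ-cong-mod : ∀ {n n′} → n % s ≡ n′ % s → dℕ n ≡ dℕ n′
  dℕ-cong-mod eq = cong ℤ.∣_∣ (d-cong-mod eq)

  dℕₛ≡a : dℕ s ≡ a
  dℕₛ≡a = trans (dℕ-cong-mod {s} {0} ([m+n]%n≡m%n 0 s)) dℕ₀≡a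

  +[p*dℕ[1+n]]≡p*d[1+n] : ∀ n → + (p ℕ.* dℕ (suc n)) ≡ + p ℤ.* d (suc n)
  +[p*dℕ[1+n]]≡p*d[1+n] n = trans (ℤ.pos-* p (dℕ (suc n))) (cong (+ p ℤ.*_) (+dℕ≡d (suc n)))

  dℕ≤p*dℕ[1+n] : ∀ n → dℕ n ℕ.≤ p ℕ.* dℕ (suc n)
  dℕ≤p*dℕ[1+n] n = ℤ.drop‿+≤+
    (subst₂ ℤ._≤_ (sym (+dℕ≡d n)) (sym (+[p*dℕ[1+n]]≡p*d[1+n] n)) (d≤p*d[1+n] n))

  p*dℕ[1+n]≤dℕ+v : ∀ n → p ℕ.* dℕ (suc n) ℕ.≤ dℕ n ℕ.+ v′ n
  p*dℕ[1+n]≤dℕ+v n = ℤ.drop‿+≤+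
    (subst₂ ℤ._≤_ (sym (+[p*dℕ[1+n]]≡p*d[1+n] n)) (cong (ℤ._+ + v′ n) (sym (+dℕ≡d n))) (p*d[1+n]≤d+v n))

  wℕ : ℕ → ℕ
  wℕ n = p ℕ.* dℕ (suc n) ℕ.∸ dℕ n

  wℕ+dℕ≡p*dℕ[1+n] : ∀ n → wℕ n ℕ.+ dℕ n ≡ p ℕ.* dℕ (suc n)
  wℕ+dℕ≡p*dℕ[1+n] n = ℕ.m∸n+n≡m (dℕ≤p*dℕ[1+n] n)

  wℕ≤v′ : ∀ n → wℕ n ℕ.≤ v′ n
  wℕ≤v′ n = subst (wℕ n ℕ.≤_) (ℕ.m+n∸m≡n (dℕ n) (v′ n)) (ℕ.∸-monoˡ-≤ (dℕ n) (p*dℕ[1+n]≤dℕ+v n))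

  wℕ-cong-mod : ∀ {n n′} → n % s ≡ n′ % s → wℕ n ≡ wℕ n′
  wℕ-cong-mod {n} {n′} eq =
    cong₂ (λ x y → p ℕ.* x ℕ.∸ y) (dℕ-cong-mod (suc-cong-mod {n} {n′} eq)) (dℕ-cong-mod eq)

  ι-wℕ : ∀ n → ι (wℕ n) ≡ ι p * ι (dℕ (suc n)) - ι (dℕ n)
  ι-wℕ n = begin
    ι (wℕ n)                          ≡⟨ solve 2 (λ w x → w := (w :+ x) :- x) refl _ (ι (dℕ n)) ⟩
    (ι (wℕ n) + ι (dℕ n)) - ι (dℕ n)  ≡⟨ cong (_- ι (dℕ n)) (ι-+ (wℕ n) (dℕ n)) ⟨
    ι (wℕ n ℕ.+ dℕ n) - ι (dℕ n)      ≡⟨ cong (λ y → ι y - ι (dℕ n)) (wℕ+dℕ≡p*dℕ[1+n] n) ⟩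
    ι (p ℕ.* dℕ (suc n)) - ι (dℕ n)   ≡⟨ cong (_- ι (dℕ n)) (ι-* p (dℕ (suc n))) ⟩
    ι p * ι (dℕ (suc n)) - ι (dℕ n)   ∎
    where open ≡-Reasoning

  fromDigits-wℕ : fromDigits wℕ s ≡ p^s∸1 ℕ.* a
  fromDigits-wℕ = begin
    fromDigits wℕ s                 ≡⟨ ℕ.m+n∸n≡m _ a ⟨
    fromDigits wℕ s ℕ.+ a ℕ.∸ a     ≡⟨ cong (λ x → fromDigits wℕ s ℕ.+ x ℕ.∸ a) dℕ₀≡a ⟨
    fromDigits wℕ s ℕ.+ dℕ 0 ℕ.∸ a  ≡⟨ cong (ℕ._∸ a) (fromDigits-telescope wℕ dℕ wℕ+dℕ≡p*dℕ[1+n] s) ⟩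
    p ^ s ℕ.* dℕ s ℕ.∸ a            ≡⟨ cong (λ x → p ^ s ℕ.* x ℕ.∸ a) dℕₛ≡a ⟩
    p ^ s ℕ.* a ℕ.∸ a               ≡⟨ cong (p ^ s ℕ.* a ℕ.∸_) (ℕ.*-identityˡ a) ⟨
    p ^ s ℕ.* a ℕ.∸ 1 ℕ.* a         ≡⟨ ℕ.*-distribʳ-∸ a (p ^ s) 1 ⟨
    p^s∸1 ℕ.* a                     ∎
    where open ≡-Reasoning

  d̂ : Fin s → ℚ
  d̂ i = ι (dℕ (toℕ i))

  ŵ : Fin s → ℕ
  ŵ i = wℕ (toℕ i)

  Ed̂≡ŵ : ∀ j → Emul p s d̂ j ≡ ι (ŵ j)
  Ed̂≡ŵ j = begin
    Emul p s d̂ j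
      ≡⟨ Emul-next p d̂ j ⟩
    ι p * ι (dℕ (toℕ (next j))) - ι (dℕ (toℕ j))
      ≡⟨ cong (λ x → ι p * ι x - ι (dℕ (toℕ j))) (dℕ-cong-mod (toℕ-fin-mod (suc (toℕ j)))) ⟩
    ι p * ι (dℕ (suc (toℕ j))) - ι (dℕ (toℕ j))
      ≡⟨ ι-wℕ (toℕ j) ⟨
    ι (ŵ j)
      ∎
    where open ≡-Reasoning

  ŵ∈𝔍 : In𝔍 p pp s ŵ
  ŵ∈𝔍 = In𝔍-intro wℕ 1≤a fromDigits-wℕ

  ŵ≤v : ∀ i → ŵ i ℕ.≤ v i
  ŵ≤v i = subst (ŵ i ℕ.≤_) (cong v (fin-toℕ i)) (wℕ≤v′ (toℕ i))

  ŵ≢v : ¬ (∀ i → ŵ i ≡ v i)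
  ŵ≢v ŵ≡v = ℚ.<-irrefl c₀-pˢ[c₀-a]≡a (x-p[x-a]<a (ι (p ^ s)) ιa<c₀ 1<ι[p^s])
    where
      1<ι[p^s] : 1ℚ < ι (p ^ s)
      1<ι[p^s] = ι-mono-< (ℕ.^-monoʳ-< p 1<p (z<s {k}))
      Ed≡v′ : ∀ n → ι (v′ n) ≡ ι p * ι (dℕ (suc n)) - ι (dℕ n)
      Ed≡v′ n = trans (cong ι (sym (trans (wℕ-cong-mod (sym (toℕ-fin-mod n))) (ŵ≡v (fin n))))) (ι-wℕ n)
      c′ₛ≡c₀ : c′ s ≡ c zero
      c′ₛ≡c₀ = cong c (fin-cong {s} {0} ([m+n]%n≡m%n 0 s))
      c₀-pˢ[c₀-a]≡a : c zero - ι (p ^ s) * (c zero - ι a) ≡ ι a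
      c₀-pˢ[c₀-a]≡a = begin
        c zero - ι (p ^ s) * (c zero - ι a)
          ≡⟨ cong (λ y → c zero - ι (p ^ s) * (y - ι a)) c′ₛ≡c₀ ⟨
        c′ 0 - ι (p ^ s) * (c′ s - ι a)
          ≡⟨ ιℤ-anchored c′ Ec′≡v′ s 0 ⟨
        ιℤ (anchored s 0)
          ≡⟨ ιℤ-anchored (ι ∘ dℕ) Ed≡v′ s 0 ⟩
        ι (dℕ 0) - ι (p ^ s) * (ι (dℕ s) - ι a)
          ≡⟨ cong₂ (λ x y → ι x - ι (p ^ s) * (ι y - ι a)) dℕ₀≡a dℕₛ≡a ⟩
        ι a - ι (p ^ s) * (ι a - ι a)
          ≡⟨ solve 2 (λ a P → a :- P :* (a :- a) := a) refl (ι a) (ι (p ^ s)) ⟩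
        ι a
          ∎
        where open ≡-Reasoning

  c₀-1≤d̂₀ : c zero - 1ℚ ≤ d̂ zero
  c₀-1≤d̂₀ = subst (λ x → c zero - 1ℚ ≤ ι x) (sym dℕ₀≡a) c₀-1≤ιa

  d̂₀≤d̂ : ∀ i → d̂ zero ≤ d̂ i
  d̂₀≤d̂ i = subst (λ x → ι x ≤ d̂ i) (sym dℕ₀≡a) (ι-mono-≤ (a≤dℕ (toℕ i)))

lemma4p4 : (p : ℕ) (pp : Prime p) (k : ℕ)
  (c : Fin (suc k) → ℚ) (v : Fin (suc k) → ℕ) →
  (∀ j → Emul p (suc k) c j ≡ ι (v j)) →
  1ℚ < c zero → (∀ i → c zero ≤ c i) →
  ∃ λ (d : Fin (suc k) → ℚ) → ∃ λ (w : Fin (suc k) → ℕ) →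
    (∀ j → Emul p (suc k) d j ≡ ι (w j)) × In𝔍 p pp (suc k) w × (w <ᵥ v) ×
    (c zero - 1ℚ ≤ d zero) × (∀ i → d zero ≤ d i)
lemma4p4 p pp k c v Ec≡v 1<c₀ c₀≤c = d̂ , ŵ , Ed̂≡ŵ , ŵ∈𝔍 , (ŵ≤v , ŵ≢v) , c₀-1≤d̂₀ , d̂₀≤d̂
  where open Construction p pp k c v Ec≡v 1<c₀ c₀≤c
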